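{- Let $\sigma\in\mathfrak{S}_n$ be double simsun. If $\Gamma(\sigma)$ is not double simsun, then $\Gamma(\sigma)$ contains a $42513$-pattern; equivalently, $\sigma$ contains a $35142$-pattern.
   Context: For $\sigma\in\mathfrak{S}_n$, a double descent is an index $i$ with $\sigma_i>\sigma_{i+1}>\sigma_{i+2}$. The permutation $\sigma$ is simsun if for every $k$, the subword of $\sigma$ consisting of the letters in $\{1,\dots,k\}$ (in the order they appear in $\sigma$) has no double descent; $\sigma$ is double simsun if both $\sigma$ and $\sigma^{ -1}$ are simsun. For $\omega\in\mathfrak{S}_t$, $\sigma$ contains an $\omega$-pattern if there are indices $i_1<\cdots<i_t$ with $\sigma_{i_j}<\sigma_{i_k}$ iff $\omega_j<\omega_k$. The map $\Gamma:\mathfrak{S}_n\to\mathfrak{S}_n$ is defined by $\Gamma(\sigma)=\omega_1\cdots\omega_n$ with $\omega_i=n+1-\sigma^{ -1}_{n+1-i}$ for $1\le i\le n$. -}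

module Defs where

open import Data.Nat using (ℕ; zero; suc; _<_; _≤_; _≤?_)
open import Data.Fin using (Fin; toℕ)
open import Data.Fin.Permutation using (Permutation′; _⟨$⟩ʳ_; _⟨$⟩ˡ_; flip; reverse; _∘ₚ_)
open import Data.List using (List; []; _∷_; map; filter)
open import Data.List.Base using (allFin)
open import Data.Vec using (Vec; lookup) renaming (_∷_ to _∷ᵥ_; [] to []ᵥ)
open import Data.Product using (_×_; Σ; ∃)
open import Data.Empty using (⊥)
open import Data.Sum using (_⊎_)
open import Data.Unit using (⊤)
open import Relation.Nullary using (¬_)
open import Function.Bundles using (_⇔_)

-- Permutations of [n] = {1..n} are represented by Permutation′ n on Fin n = {0..n-1};
-- values are shifted by one (toℕ), which does not affect any comparison.

word : ∀ {n} → Permutation′ n → List ℕ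
word σ = map (λ i → toℕ (σ ⟨$⟩ʳ i)) (allFin _)

HasDoubleDescent : List ℕ → Set
HasDoubleDescent []               = ⊥
HasDoubleDescent (a ∷ [])         = ⊥
HasDoubleDescent (a ∷ b ∷ [])     = ⊥
HasDoubleDescent (a ∷ b ∷ c ∷ w)  = (b < a × c < b) ⊎ HasDoubleDescent (b ∷ c ∷ w)

-- Subword of w consisting of the letters in {1,…,k}; with 0-based values this is
-- the letters v with v < k.
restrict : ℕ → List ℕ → List ℕ
restrict k w = filter (λ v → suc v ≤? k) w

Simsun : ∀ {n} → Permutation′ n → Set
Simsun σ = ∀ (k : ℕ) → ¬ HasDoubleDescent (restrict k (word σ))

DoubleSimsun : ∀ {n} → Permutation′ n → Set
DoubleSimsun σ = Simsun σ × Simsun (flip σ)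

ContainsPattern : ∀ {n t} → Permutation′ n → (Fin t → ℕ) → Set
ContainsPattern {n} {t} σ ω =
  Σ (Fin t → Fin n) λ ι →
    (∀ (j k : Fin t) → toℕ j < toℕ k → toℕ (ι j) < toℕ (ι k)) ×
    (∀ (j k : Fin t) → (toℕ (σ ⟨$⟩ʳ ι j) < toℕ (σ ⟨$⟩ʳ ι k)) ⇔ (ω j < ω k))

-- Γ(σ) = ω₁⋯ωₙ with ωᵢ = n+1-σ⁻¹_{n+1-i}.  In 0-based terms:
-- Γ(σ)(i) = opposite (σ⁻¹ (opposite i)), where reverse is i ↦ opposite i.
Γ : ∀ {n} → Permutation′ n → Permutation′ n
Γ σ = reverse ∘ₚ (flip σ ∘ₚ reverse)

p42513 : Fin 5 → ℕ
p42513 = lookup (4 ∷ᵥ 2 ∷ᵥ 5 ∷ᵥ 1 ∷ᵥ 3 ∷ᵥ []ᵥ)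

p35142 : Fin 5 → ℕ
p35142 = lookup (3 ∷ᵥ 5 ∷ᵥ 1 ∷ᵥ 4 ∷ᵥ 2 ∷ᵥ []ᵥ)

module Submission where

-- A double descent of the subword of
-- letters below k is a double descent i < j < l of the permutation such that every other
-- position strictly between i and l carries a letter ≥ k.  Taking k = τᵢ + 1, τ is simsun iff
-- it has no *exposed* double descent: τᵢ > τⱼ > τₗ with every other letter strictly between
-- positions i and l larger than τᵢ.  Since Γ(σ) is the reverse-complement of σ⁻¹ (and Γ(σ)⁻¹
-- that of σ), and reverse-complement turns an exposed double descent into a *sunken* one
-- (every other letter in between is smaller than τₗ), the core lemma reads: if τ and τ⁻¹ are
-- simsun and τ has a sunken double descent I < J < L, then τ contains 35142 at p < I < s < J < L.
-- Simsun-ness of τ yields s; if no suitable p existed, the position q < L carrying the least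
-- letter above τ_J would give an exposed double descent of τ⁻¹ at the letters L > J > q.
-- As 35142 is an involution whose reverse-complement is 42513, the theorem follows by applying
-- the core lemma to σ or to σ⁻¹, whichever has a non-simsun reverse-complement.

open import Defs
open import Data.Nat using (ℕ; zero; suc; _<_; _≤_; _≤?_; _<?_; _≟_; s≤s; z≤n; s≤s⁻¹)
open import Data.Nat.Properties
  using (<-trans; <-irrefl; <-asym; <-cmp; ≤-antisym; ≤∧≢⇒<; ≤-<-trans; <-≤-trans; n<1+n;
         m<n⇒m<1+n; ≮⇒≥; <⇒≱; ∸-monoʳ-<)
open import Data.Nat.Induction using (<-wellFounded)
open import Data.Fin using (Fin; zero; suc; toℕ; fromℕ<; opposite; inject₁)
open import Data.Fin.Properties
  using (toℕ-injective; toℕ<n; toℕ-fromℕ<; opposite-prop; opposite-involutive; any?; all?)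
  renaming (_≟_ to _≟ᶠ_)
open import Data.Fin.Permutation using (Permutation′; _⟨$⟩ʳ_; _⟨$⟩ˡ_; flip; inverseˡ; inverseʳ)
open import Data.List using (List; _∷_; filter; tabulate)
open import Data.List.Properties using (filter-accept; filter-reject; map-tabulate; ∷-injectiveˡ; ∷-injectiveʳ)
open import Data.Vec using (lookup) renaming (_∷_ to _∷ᵥ_; [] to []ᵥ)
open import Data.Product using (_×_; Σ; ∃; _,_; proj₁; proj₂)
open import Data.Sum using (_⊎_; inj₁; inj₂)
open import Data.Empty using (⊥-elim)
open import Induction.WellFounded using (Acc; acc)
open import Relation.Nullary using (¬_; Dec; yes; no)
open import Relation.Nullary.Decidable using (_×-dec_; _→-dec_; ¬?; map′)
open import Relation.Unary using (Decidable)
open import Relation.Binary using (tri<; tri≈; tri>)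
open import Relation.Binary.PropositionalEquality
  using (_≡_; _≢_; refl; sym; trans; cong; subst; subst₂; module ≡-Reasoning)
open import Function.Bundles using (mk⇔)
open import Function using (_∘_)

-- Double descents in subwords of a tabulated word, located by positions

record SubwordDescent {n} (P : ℕ → Set) (f : Fin n → ℕ) : Set where
  constructor subwordDescent
  field
    i j l   : Fin n
    i<j     : toℕ i < toℕ j
    j<l     : toℕ j < toℕ l
    fj<fi   : f j < f i
    fl<fj   : f l < f j
    Pi      : P (f i)
    Pj      : P (f j)
    Pl      : P (f l)
    skipped : ∀ m → toℕ i < toℕ m → toℕ m < toℕ l → m ≢ j → ¬ P (f m)

-- A double descent of the filtered word exists exactly when a SubwordDescent does
-- (extract and realize); both directions go through the first one or two P-positions.
module FilteredWord {P : ℕ → Set} (P? : Decidable P) where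

  subword : ∀ {n} → (Fin n → ℕ) → List ℕ
  subword f = filter P? (tabulate f)

  FirstAt : ∀ {n} → (Fin n → ℕ) → Fin n → Set
  FirstAt f l = P (f l) × (∀ m → toℕ m < toℕ l → ¬ P (f m))

  FirstTwoAt : ∀ {n} → (Fin n → ℕ) → Fin n → Fin n → Set
  FirstTwoAt f j l = toℕ j < toℕ l × P (f j) × P (f l) × (∀ m → toℕ m < toℕ l → m ≢ j → ¬ P (f m))

  first-at : ∀ {n} (f : Fin n → ℕ) {c r} → subword f ≡ c ∷ r → ∃ λ l → f l ≡ c × FirstAt f l
  first-at {zero} f ()
  first-at {suc n} f {c} eq = by-head (P? (f zero))
    where
    by-head : Dec (P (f zero)) → ∃ λ l → f l ≡ c × FirstAt f l
    by-head (yes p) = zero , ∷-injectiveˡ (trans (sym (filter-accept P? p)) eq) , p , λ _ ()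
    by-head (no ¬p) with first-at (f ∘ suc) (trans (sym (filter-reject P? ¬p)) eq)
    ... | l , fl≡c , pl , none = suc l , fl≡c , pl , λ { zero _ → ¬p ; (suc m) (s≤s m<l) → none m m<l }

  first-two-at : ∀ {n} (f : Fin n → ℕ) {b c r} → subword f ≡ b ∷ c ∷ r →
                 ∃ λ j → ∃ λ l → f j ≡ b × f l ≡ c × FirstTwoAt f j l
  first-two-at {zero} f ()
  first-two-at {suc n} f {b} {c} eq = by-head (P? (f zero))
    where
    by-head : Dec (P (f zero)) → ∃ λ j → ∃ λ l → f j ≡ b × f l ≡ c × FirstTwoAt f j l
    by-head (yes p) with first-at (f ∘ suc) (∷-injectiveʳ (trans (sym (filter-accept P? p)) eq))
    ... | l , fl≡c , pl , none =
      zero , suc l , ∷-injectiveˡ (trans (sym (filter-accept P? p)) eq) , fl≡c , s≤s z≤n , p , pl ,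
      λ { zero _ m≢0 → ⊥-elim (m≢0 refl) ; (suc m) (s≤s m<l) _ → none m m<l }
    by-head (no ¬p) with first-two-at (f ∘ suc) (trans (sym (filter-reject P? ¬p)) eq)
    ... | j , l , fj≡b , fl≡c , j<l , pj , pl , none =
      suc j , suc l , fj≡b , fl≡c , s≤s j<l , pj , pl ,
      λ { zero _ _ → ¬p ; (suc m) (s≤s m<l) m≢j → none m m<l (m≢j ∘ cong suc) }

  first-at⁻¹ : ∀ {n} (f : Fin n → ℕ) l → FirstAt f l → ∃ λ r → subword f ≡ f l ∷ r
  first-at⁻¹ {suc n} f zero (pl , _) = subword (f ∘ suc) , filter-accept P? pl
  first-at⁻¹ {suc n} f (suc l) (pl , none) with first-at⁻¹ (f ∘ suc) l (pl , λ m m<l → none (suc m) (s≤s m<l))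
  ... | r , eq = r , trans (filter-reject P? (none zero (s≤s z≤n))) eq

  first-two-at⁻¹ : ∀ {n} (f : Fin n → ℕ) j l → FirstTwoAt f j l → ∃ λ r → subword f ≡ f j ∷ f l ∷ r
  first-two-at⁻¹ {suc n} f zero (suc l) (_ , pj , pl , none)
    with first-at⁻¹ (f ∘ suc) l (pl , λ m m<l → none (suc m) (s≤s m<l) (λ ()))
  ... | r , eq = r , trans (filter-accept P? pj) (cong (f zero ∷_) eq)
  first-two-at⁻¹ {suc n} f (suc j) (suc l) (s≤s j<l , pj , pl , none)
    with first-two-at⁻¹ (f ∘ suc) j l (j<l , pj , pl , λ m m<l m≢j → none (suc m) (s≤s m<l) λ { refl → m≢j refl })
  ... | r , eq = r , trans (filter-reject P? (none zero (s≤s z≤n) (λ ()))) eq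

  shift : ∀ {n} {f : Fin (suc n) → ℕ} → SubwordDescent P (f ∘ suc) → SubwordDescent P f
  shift (subwordDescent i j l i<j j<l fj<fi fl<fj Pi Pj Pl skipped) =
    subwordDescent (suc i) (suc j) (suc l) (s≤s i<j) (s≤s j<l) fj<fi fl<fj Pi Pj Pl
      λ { zero () ; (suc m) (s≤s i<m) (s≤s m<l) m≢j → skipped m i<m m<l (m≢j ∘ cong suc) }

  extract : ∀ {n} (f : Fin n → ℕ) → HasDoubleDescent (subword f) → SubwordDescent P f
  extract {zero} f ()
  extract {suc n} f dd = by-head (P? (f zero))
    where
    kept : P (f zero) → (w : List ℕ) → subword (f ∘ suc) ≡ w → HasDoubleDescent (f zero ∷ w) →
           SubwordDescent P f
    kept p (b ∷ c ∷ r) eq (inj₁ (b<a , c<b)) with first-two-at (f ∘ suc) eq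
    ... | j , l , fj≡b , fl≡c , j<l , pj , pl , none =
      subwordDescent zero (suc j) (suc l) (s≤s z≤n) (s≤s j<l)
        (subst (_< f zero) (sym fj≡b) b<a) (subst₂ _<_ (sym fl≡c) (sym fj≡b) c<b) p pj pl
        λ { (suc m) _ (s≤s m<l) m≢j → none m m<l (m≢j ∘ cong suc) }
    kept p (b ∷ c ∷ r) eq (inj₂ dd′) = shift (extract (f ∘ suc) (subst HasDoubleDescent (sym eq) dd′))
    by-head : Dec (P (f zero)) → SubwordDescent P f
    by-head (yes p) = kept p _ refl (subst HasDoubleDescent (filter-accept P? p) dd)
    by-head (no ¬p) = shift (extract (f ∘ suc) (subst HasDoubleDescent (filter-reject P? ¬p) dd))

  realize : ∀ {n} (f : Fin n → ℕ) → SubwordDescent P f → HasDoubleDescent (subword f)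
  realize {suc n} f (subwordDescent zero (suc j) (suc l) _ (s≤s j<l) fj<fi fl<fj Pi Pj Pl skipped)
    with first-two-at⁻¹ (f ∘ suc) j l
           (j<l , Pj , Pl , λ m m<l m≢j → skipped (suc m) (s≤s z≤n) (s≤s m<l) λ { refl → m≢j refl })
  ... | r , eq = subst HasDoubleDescent (sym (trans (filter-accept P? Pi) (cong (f zero ∷_) eq))) (inj₁ (fj<fi , fl<fj))
  realize {suc n} f (subwordDescent (suc i) (suc j) (suc l) (s≤s i<j) (s≤s j<l) fj<fi fl<fj Pi Pj Pl skipped) =
    by-head (P? (f zero))
    where
    rest : HasDoubleDescent (subword (f ∘ suc))
    rest = realize (f ∘ suc) (subwordDescent i j l i<j j<l fj<fi fl<fj Pi Pj Pl
             λ m i<m m<l m≢j → skipped (suc m) (s≤s i<m) (s≤s m<l) λ { refl → m≢j refl })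
    prepend : ∀ x (w : List ℕ) → HasDoubleDescent w → HasDoubleDescent (x ∷ w)
    prepend x (_ ∷ _ ∷ _ ∷ _) dd = inj₂ dd
    by-head : Dec (P (f zero)) → HasDoubleDescent (subword f)
    by-head (yes p) = subst HasDoubleDescent (sym (filter-accept P? p)) (prepend (f zero) _ rest)
    by-head (no ¬p) = subst HasDoubleDescent (sym (filter-reject P? ¬p)) rest

open FilteredWord using (extract; realize)

-- Simsun permutations are those without exposed double descents

gOf : ∀ {n} → Permutation′ n → Fin n → ℕ
gOf τ i = toℕ (τ ⟨$⟩ʳ i)

word≡tabulate : ∀ {n} (τ : Permutation′ n) → word τ ≡ tabulate (gOf τ)
word≡tabulate τ = map-tabulate (λ i → i) (gOf τ)

below? : ∀ k → Decidable (_< k)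
below? k v = suc v ≤? k

record ExposedDescent {n} (f : Fin n → ℕ) : Set where
  constructor exposed
  field
    i j l : Fin n
    i<j   : toℕ i < toℕ j
    j<l   : toℕ j < toℕ l
    fj<fi : f j < f i
    fl<fj : f l < f j
    above : ∀ m → toℕ i < toℕ m → toℕ m < toℕ l → m ≢ j → f i < f m

exposed⇒subwordDescent : ∀ {n} {f : Fin n → ℕ} (e : ExposedDescent f) →
                         SubwordDescent (_< suc (f (ExposedDescent.i e))) f
exposed⇒subwordDescent (exposed i j l i<j j<l fj<fi fl<fj above) =
  subwordDescent i j l i<j j<l fj<fi fl<fj (n<1+n _) (m<n⇒m<1+n fj<fi) (m<n⇒m<1+n (<-trans fl<fj fj<fi))
    λ m i<m m<l m≢j fm≤fi → <⇒≱ (above m i<m m<l m≢j) (s≤s⁻¹ fm≤fi)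

subwordDescent⇒exposed : ∀ {n k} {f : Fin n → ℕ} → SubwordDescent (_< k) f → ExposedDescent f
subwordDescent⇒exposed (subwordDescent i j l i<j j<l fj<fi fl<fj Pi _ _ skipped) =
  exposed i j l i<j j<l fj<fi fl<fj λ m i<m m<l m≢j → <-≤-trans Pi (≮⇒≥ (skipped m i<m m<l m≢j))

simsun⇒no-exposed : ∀ {n} (τ : Permutation′ n) → Simsun τ → ¬ ExposedDescent (gOf τ)
simsun⇒no-exposed τ simsun e =
  simsun _ (subst HasDoubleDescent (sym (cong (restrict _) (word≡tabulate τ)))
             (realize (below? _) (gOf τ) (exposed⇒subwordDescent e)))

exposed? : ∀ {n} (f : Fin n → ℕ) → Dec (ExposedDescent f)
exposed? f = map′ (λ (i , j , l , i<j , j<l , fj<fi , fl<fj , above) → exposed i j l i<j j<l fj<fi fl<fj above)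
                  (λ (exposed i j l i<j j<l fj<fi fl<fj above) → i , j , l , i<j , j<l , fj<fi , fl<fj , above)
  (any? λ i → any? λ j → any? λ l →
     (toℕ i <? toℕ j) ×-dec (toℕ j <? toℕ l) ×-dec (f j <? f i) ×-dec (f l <? f j) ×-dec
     all? λ m → (toℕ i <? toℕ m) →-dec (toℕ m <? toℕ l) →-dec ¬? (m ≟ᶠ j) →-dec (f i <? f m))

simsun-or-exposed : ∀ {n} (τ : Permutation′ n) → Simsun τ ⊎ ExposedDescent (gOf τ)
simsun-or-exposed τ with exposed? (gOf τ)
... | yes e = inj₂ e
... | no ¬e = inj₁ λ k dd → ¬e (subwordDescent⇒exposed
                (extract (below? k) (gOf τ) (subst HasDoubleDescent (cong (restrict k) (word≡tabulate τ)) dd)))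

-- Reverse-complement and sunken double descents

opposite-reverses : ∀ {n} {a b : Fin n} → toℕ a < toℕ b → toℕ (opposite b) < toℕ (opposite a)
opposite-reverses {n} {a} {b} a<b =
  subst₂ _<_ (sym (opposite-prop b)) (sym (opposite-prop a)) (∸-monoʳ-< (s≤s a<b) (toℕ<n b))

opposite-reflects : ∀ {n} {a b : Fin n} → toℕ (opposite a) < toℕ (opposite b) → toℕ b < toℕ a
opposite-reflects {a = a} {b} lt =
  subst₂ (λ x y → toℕ x < toℕ y) (opposite-involutive b) (opposite-involutive a) (opposite-reverses lt)

record SunkenDescent {n} (f : Fin n → ℕ) : Set where
  constructor sunken
  field
    I J L : Fin n
    I<J   : toℕ I < toℕ J
    J<L   : toℕ J < toℕ L
    fJ<fI : f J < f I
    fL<fJ : f L < f J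
    below : ∀ m → toℕ I < toℕ m → toℕ m < toℕ L → m ≢ J → f m < f L

exposed-rc⇒sunken : ∀ {n} (φ : Fin n → Fin n) →
  ExposedDescent (λ x → toℕ (opposite (φ (opposite x)))) → SunkenDescent (λ x → toℕ (φ x))
exposed-rc⇒sunken φ (exposed i j l i<j j<l fj<fi fl<fj above) =
  sunken (opposite l) (opposite j) (opposite i) (opposite-reverses j<l) (opposite-reverses i<j)
    (opposite-reflects fl<fj) (opposite-reflects fj<fi) below
  where
  below : ∀ m → toℕ (opposite l) < toℕ m → toℕ m < toℕ (opposite i) → m ≢ opposite j →
          toℕ (φ m) < toℕ (φ (opposite i))
  below m l′<m m<i′ m≢j′ =
    subst (λ x → toℕ (φ x) < toℕ (φ (opposite i))) (opposite-involutive m)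
      (opposite-reflects (above (opposite m) i<m′ m′<l m′≢j))
    where
    i<m′ : toℕ i < toℕ (opposite m)
    i<m′ = subst (λ x → toℕ x < toℕ (opposite m)) (opposite-involutive i) (opposite-reverses m<i′)
    m′<l : toℕ (opposite m) < toℕ l
    m′<l = subst (λ x → toℕ (opposite m) < toℕ x) (opposite-involutive l) (opposite-reverses l′<m)
    m′≢j : opposite m ≢ j
    m′≢j e = m≢j′ (trans (sym (opposite-involutive m)) (cong opposite e))

successor : ∀ {n} (a b : Fin n) → toℕ a < toℕ b → Σ (Fin n) λ c → toℕ c ≡ suc (toℕ a)
successor a b a<b = fromℕ< (≤-<-trans a<b (toℕ<n b)) , toℕ-fromℕ< _

inverse-at : ∀ {n} (τ : Permutation′ n) x → gOf (flip τ) (τ ⟨$⟩ʳ x) ≡ toℕ x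
inverse-at τ x = cong toℕ (inverseˡ τ)

at-inverse : ∀ {n} (τ : Permutation′ n) m → gOf τ (τ ⟨$⟩ˡ m) ≡ toℕ m
at-inverse τ m = cong toℕ (inverseʳ τ)

gOf-injective : ∀ {n} (τ : Permutation′ n) {x y} → gOf τ x ≡ gOf τ y → x ≡ y
gOf-injective τ {x} {y} e = begin
  x                         ≡⟨ sym (inverseˡ τ) ⟩
  τ ⟨$⟩ˡ (τ ⟨$⟩ʳ x)         ≡⟨ cong (τ ⟨$⟩ˡ_) (toℕ-injective e) ⟩
  τ ⟨$⟩ˡ (τ ⟨$⟩ʳ y)         ≡⟨ inverseˡ τ ⟩
  y                         ∎
  where open ≡-Reasoning

least : ∀ {n} {P : Fin n → Set} → Decidable P → (f : Fin n → ℕ) →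
        ∃ P → ∃ λ q → P q × (∀ p → P p → ¬ f p < f q)
least {P = P} P? f (q₀ , Pq₀) = descend q₀ Pq₀ (<-wellFounded (f q₀))
  where
  descend : ∀ q → P q → Acc _<_ (f q) → ∃ λ q → P q × (∀ p → P p → ¬ f p < f q)
  descend q Pq (acc smaller) with any? (λ p → P? p ×-dec (f p <? f q))
  ... | yes (p , Pp , fp<fq) = descend p Pp (smaller fp<fq)
  ... | no none = q , Pq , λ p Pp fp<fq → none (p , Pp , fp<fq)

-- The core lemma: a sunken double descent in a double simsun permutation forces 35142

record Occ35142 {n} (f : Fin n → ℕ) : Set where
  constructor occ35142
  field
    x₁ x₂ x₃ x₄ x₅ : Fin n
    x₁<x₂ : toℕ x₁ < toℕ x₂
    x₂<x₃ : toℕ x₂ < toℕ x₃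
    x₃<x₄ : toℕ x₃ < toℕ x₄
    x₄<x₅ : toℕ x₄ < toℕ x₅
    f₃<f₅ : f x₃ < f x₅
    f₅<f₁ : f x₅ < f x₁
    f₁<f₄ : f x₁ < f x₄
    f₄<f₂ : f x₄ < f x₂

module SunkenCore {n} (τ : Permutation′ n) (sd : SunkenDescent (gOf τ)) where
  open SunkenDescent sd

  g : Fin n → ℕ
  g = gOf τ

  classify : ∀ p → toℕ p < toℕ L → toℕ p < toℕ I ⊎ p ≡ I ⊎ p ≡ J ⊎ g p < g L
  classify p p<L with <-cmp (toℕ p) (toℕ I)
  ... | tri< p<I _ _ = inj₁ p<I
  ... | tri≈ _ p≡I _ = inj₂ (inj₁ (toℕ-injective p≡I))
  ... | tri> _ _ I<p with toℕ p ≟ toℕ J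
  ...   | yes p≡J = inj₂ (inj₂ (inj₁ (toℕ-injective p≡J)))
  ...   | no p≢J = inj₂ (inj₂ (inj₂ (below p I<p p<L (p≢J ∘ cong toℕ))))

  -- If J = I + 1, then I, J, J + 1 is an exposed double descent: nothing lies in between.
  adjacent-exposed : toℕ J ≡ suc (toℕ I) → ExposedDescent g
  adjacent-exposed J≡I+1 with successor J L J<L
  ... | X , X≡J+1 = exposed I J X I<J J<X fJ<fI gX<gJ nothing-between
    where
    J<X : toℕ J < toℕ X
    J<X = subst (toℕ J <_) (sym X≡J+1) (n<1+n _)
    X≢J : X ≢ J
    X≢J X≡J = <-irrefl (cong toℕ (sym X≡J)) J<X
    gX<gJ : g X < g J
    gX<gJ with toℕ X ≟ toℕ L
    ... | yes X≡L = subst (λ y → g y < g J) (sym (toℕ-injective X≡L)) fL<fJ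
    ... | no X≢L = <-trans (below X (<-trans I<J J<X)
                             (≤∧≢⇒< (subst (_≤ toℕ L) (sym X≡J+1) J<L) X≢L) X≢J) fL<fJ
    nothing-between : ∀ m → toℕ I < toℕ m → toℕ m < toℕ X → m ≢ J → g I < g m
    nothing-between m I<m m<X m≢J = ⊥-elim (m≢J (toℕ-injective
      (≤-antisym (s≤s⁻¹ (subst (toℕ m <_) X≡J+1 m<X)) (subst (_≤ toℕ m) (sym J≡I+1) I<m))))

  inner-low : Simsun τ → ∃ λ s → toℕ I < toℕ s × toℕ s < toℕ J × g s < g L
  inner-low τ-simsun with successor I J I<J
  ... | s , s≡I+1 with toℕ s ≟ toℕ J
  ...   | yes s≡J = ⊥-elim (simsun⇒no-exposed τ τ-simsun (adjacent-exposed (trans (sym s≡J) s≡I+1)))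
  ...   | no s≢J = s , I<s , s<J , below s I<s (<-trans s<J J<L) (s≢J ∘ cong toℕ)
    where
    I<s : toℕ I < toℕ s
    I<s = subst (toℕ I <_) (sym s≡I+1) (n<1+n _)
    s<J : toℕ s < toℕ J
    s<J = ≤∧≢⇒< (subst (_≤ toℕ J) (sym s≡I+1) I<J) s≢J

  left-of-J : ∀ p → toℕ p < toℕ L → g J < g p → toℕ p < toℕ J
  left-of-J p p<L gJ<gp with classify p p<L
  ... | inj₁ p<I = <-trans p<I I<J
  ... | inj₂ (inj₁ refl) = I<J
  ... | inj₂ (inj₂ (inj₁ refl)) = ⊥-elim (<-irrefl refl gJ<gp)
  ... | inj₂ (inj₂ (inj₂ gp<gL)) = ⊥-elim (<-asym gJ<gp (<-trans gp<gL fL<fJ))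

  Band : Set
  Band = ∃ λ p → toℕ p < toℕ I × g L < g p × g p < g J

  -- The candidates for the last letter of the exposed descent of τ⁻¹ built below.
  AboveJ : Fin n → Set
  AboveJ q = g J < g q × toℕ q < toℕ L

  module LeastAboveJ (q : Fin n) (q-least : ∀ p → AboveJ p → ¬ g p < g q) where

    under-J : ∀ p → toℕ p < toℕ L → g p < g q → p ≢ J → g p < g J
    under-J p p<L gp<gq p≢J with <-cmp (g p) (g J)
    ... | tri< gp<gJ _ _ = gp<gJ
    ... | tri≈ _ gp≡gJ _ = ⊥-elim (p≢J (gOf-injective τ gp≡gJ))
    ... | tri> _ _ gJ<gp = ⊥-elim (q-least p (gJ<gp , p<L) gp<gq)

    right-of-L : ¬ Band → ∀ p → g L < g p → g p < g q → p ≢ J → toℕ L < toℕ p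
    right-of-L no-band p gL<gp gp<gq p≢J with <-cmp (toℕ p) (toℕ L)
    ... | tri> _ _ L<p = L<p
    ... | tri≈ _ p≡L _ = ⊥-elim (<-irrefl (cong g (sym (toℕ-injective p≡L))) gL<gp)
    ... | tri< p<L _ _ with classify p p<L
    ...   | inj₁ p<I = ⊥-elim (no-band (p , p<I , gL<gp , under-J p p<L gp<gq p≢J))
    ...   | inj₂ (inj₁ refl) = ⊥-elim (<-asym (under-J p p<L gp<gq p≢J) fJ<fI)
    ...   | inj₂ (inj₂ (inj₁ p≡J)) = ⊥-elim (p≢J p≡J)
    ...   | inj₂ (inj₂ (inj₂ gp<gL)) = ⊥-elim (<-asym gL<gp gp<gL)

    -- Hence τ⁻¹ has the exposed double descent at positions g L < g J < g q, letters L > J > q.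
    inverse-exposed : AboveJ q → ¬ Band → ExposedDescent (gOf (flip τ))
    inverse-exposed (gJ<gq , q<L) no-band =
      exposed (τ ⟨$⟩ʳ L) (τ ⟨$⟩ʳ J) (τ ⟨$⟩ʳ q) fL<fJ gJ<gq
        (subst₂ _<_ (sym (inverse-at τ J)) (sym (inverse-at τ L)) J<L)
        (subst₂ _<_ (sym (inverse-at τ q)) (sym (inverse-at τ J)) (left-of-J q q<L gJ<gq))
        above
      where
      above : ∀ m → g L < toℕ m → toℕ m < g q → m ≢ τ ⟨$⟩ʳ J →
              gOf (flip τ) (τ ⟨$⟩ʳ L) < gOf (flip τ) m
      above m gL<m m<gq m≢τJ = subst (_< toℕ (τ ⟨$⟩ˡ m)) (sym (inverse-at τ L))
        (right-of-L no-band (τ ⟨$⟩ˡ m)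
          (subst (g L <_) (sym (at-inverse τ m)) gL<m)
          (subst (_< g q) (sym (at-inverse τ m)) m<gq)
          λ p≡J → m≢τJ (trans (sym (inverseʳ τ)) (cong (τ ⟨$⟩ʳ_) p≡J)))

  outer-band : Simsun (flip τ) → Band
  outer-band τ⁻¹-simsun with any? (λ p → (toℕ p <? toℕ I) ×-dec (g L <? g p) ×-dec (g p <? g J))
  ... | yes band = band
  ... | no no-band with least (λ q → (g J <? g q) ×-dec (toℕ q <? toℕ L)) g (I , fJ<fI , <-trans I<J J<L)
  ...   | q , above-J , q-least =
    ⊥-elim (simsun⇒no-exposed (flip τ) τ⁻¹-simsun (LeastAboveJ.inverse-exposed q q-least above-J no-band))

  occurrence : Simsun τ → Simsun (flip τ) → Occ35142 g
  occurrence τ-simsun τ⁻¹-simsun with outer-band τ⁻¹-simsun | inner-low τ-simsun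
  ... | p , p<I , gL<gp , gp<gJ | s , I<s , s<J , gs<gL =
    occ35142 p I s J L p<I I<s s<J J<L gs<gL gL<gp gp<gJ fJ<fI

sunken⇒35142 : ∀ {n} (τ : Permutation′ n) → Simsun τ → Simsun (flip τ) →
               SunkenDescent (gOf τ) → Occ35142 (gOf τ)
sunken⇒35142 τ τ-simsun τ⁻¹-simsun sd = SunkenCore.occurrence τ sd τ-simsun τ⁻¹-simsun

-- Transporting occurrences along inversion and reverse-complement

-- 35142 is an involution, so its occurrences pass from τ to τ⁻¹.
occ35142-inverse : ∀ {n} (τ : Permutation′ n) → Occ35142 (gOf τ) → Occ35142 (gOf (flip τ))
occ35142-inverse τ (occ35142 x₁ x₂ x₃ x₄ x₅ x₁<x₂ x₂<x₃ x₃<x₄ x₄<x₅ f₃<f₅ f₅<f₁ f₁<f₄ f₄<f₂) =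
  occ35142 (τ ⟨$⟩ʳ x₃) (τ ⟨$⟩ʳ x₅) (τ ⟨$⟩ʳ x₁) (τ ⟨$⟩ʳ x₄) (τ ⟨$⟩ʳ x₂) f₃<f₅ f₅<f₁ f₁<f₄ f₄<f₂
    (letters x₁<x₂) (letters x₂<x₃) (letters x₃<x₄) (letters x₄<x₅)
  where
  letters : ∀ {a b} → toℕ a < toℕ b → gOf (flip τ) (τ ⟨$⟩ʳ a) < gOf (flip τ) (τ ⟨$⟩ʳ b)
  letters {a} {b} = subst₂ _<_ (sym (inverse-at τ a)) (sym (inverse-at τ b))

record Occ42513 {n} (f : Fin n → ℕ) : Set where
  constructor occ42513
  field
    y₁ y₂ y₃ y₄ y₅ : Fin n
    y₁<y₂ : toℕ y₁ < toℕ y₂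
    y₂<y₃ : toℕ y₂ < toℕ y₃
    y₃<y₄ : toℕ y₃ < toℕ y₄
    y₄<y₅ : toℕ y₄ < toℕ y₅
    f₄<f₂ : f y₄ < f y₂
    f₂<f₅ : f y₂ < f y₅
    f₅<f₁ : f y₅ < f y₁
    f₁<f₃ : f y₁ < f y₃

occ35142-rc : ∀ {n} (φ : Fin n → Fin n) →
  Occ35142 (λ x → toℕ (φ x)) → Occ42513 (λ x → toℕ (opposite (φ (opposite x))))
occ35142-rc φ (occ35142 x₁ x₂ x₃ x₄ x₅ x₁<x₂ x₂<x₃ x₃<x₄ x₄<x₅ f₃<f₅ f₅<f₁ f₁<f₄ f₄<f₂) =
  occ42513 (opposite x₅) (opposite x₄) (opposite x₃) (opposite x₂) (opposite x₁)
    (opposite-reverses x₄<x₅) (opposite-reverses x₃<x₄) (opposite-reverses x₂<x₃) (opposite-reverses x₁<x₂)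
    (letters f₄<f₂) (letters f₁<f₄) (letters f₅<f₁) (letters f₃<f₅)
  where
  at-opposite : ∀ x → toℕ (opposite (φ (opposite (opposite x)))) ≡ toℕ (opposite (φ x))
  at-opposite x = cong (λ z → toℕ (opposite (φ z))) (opposite-involutive x)
  letters : ∀ {a b} → toℕ (φ a) < toℕ (φ b) →
            toℕ (opposite (φ (opposite (opposite b)))) < toℕ (opposite (φ (opposite (opposite a))))
  letters {a} {b} lt = subst₂ _<_ (sym (at-opposite b)) (sym (at-opposite a)) (opposite-reverses lt)

StrictlyIncreasing : ∀ {t} → (Fin t → ℕ) → Set
StrictlyIncreasing u = ∀ a b → toℕ a < toℕ b → u a < u b

stepwise⇒increasing : ∀ {t} (u : Fin (suc t) → ℕ) →
                      (∀ (a : Fin t) → u (inject₁ a) < u (suc a)) → StrictlyIncreasing u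
stepwise⇒increasing u step _ zero ()
stepwise⇒increasing u step zero (suc zero) _ = step zero
stepwise⇒increasing {suc t} u step zero (suc (suc b)) _ =
  <-trans (step zero) (stepwise⇒increasing (u ∘ suc) (step ∘ suc) zero (suc b) (s≤s z≤n))
stepwise⇒increasing {suc t} u step (suc a) (suc b) (s≤s a<b) = stepwise⇒increasing (u ∘ suc) (step ∘ suc) a b a<b

increasing₅ : (u : Fin 5 → ℕ) → u zero < u (suc zero) → u (suc zero) < u (suc (suc zero)) →
  u (suc (suc zero)) < u (suc (suc (suc zero))) → u (suc (suc (suc zero))) < u (suc (suc (suc (suc zero)))) →
  StrictlyIncreasing u
increasing₅ u u₀<u₁ u₁<u₂ u₂<u₃ u₃<u₄ = stepwise⇒increasing u
  λ { zero → u₀<u₁ ; (suc zero) → u₁<u₂ ; (suc (suc zero)) → u₂<u₃ ; (suc (suc (suc zero))) → u₃<u₄ }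

increasing-reflects : ∀ {t} (u : Fin t → ℕ) → StrictlyIncreasing u → ∀ a b → u a < u b → toℕ a < toℕ b
increasing-reflects u increasing a b ua<ub with <-cmp (toℕ a) (toℕ b)
... | tri< a<b _ _ = a<b
... | tri≈ _ a≡b _ = ⊥-elim (<-irrefl (cong u (toℕ-injective a≡b)) ua<ub)
... | tri> _ _ b<a = ⊥-elim (<-asym ua<ub (increasing b a b<a))

-- σ contains ω at the increasing positions ι if the letter at ι j is u (ρ j), where u is
-- increasing and ρ j = ω j - 1 is the rank of ω j.
contains-by-ranks : ∀ {n t} (σ : Permutation′ n) (ω : Fin t → ℕ) (ρ : Fin t → Fin t) →
  (∀ j → ω j ≡ suc (toℕ (ρ j))) → (ι : Fin t → Fin n) (u : Fin t → ℕ) →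
  StrictlyIncreasing (toℕ ∘ ι) → StrictlyIncreasing u →
  (∀ j → gOf σ (ι j) ≡ u (ρ j)) → ContainsPattern σ ω
contains-by-ranks σ ω ρ ω≡ρ+1 ι u ι-increasing u-increasing letter =
  ι , ι-increasing , λ j k → mk⇔
    (λ σj<σk → subst₂ _<_ (sym (ω≡ρ+1 j)) (sym (ω≡ρ+1 k))
                 (s≤s (increasing-reflects u u-increasing (ρ j) (ρ k) (subst₂ _<_ (letter j) (letter k) σj<σk))))
    (λ ωj<ωk → subst₂ _<_ (sym (letter j)) (sym (letter k))
                 (u-increasing (ρ j) (ρ k) (s≤s⁻¹ (subst₂ _<_ (ω≡ρ+1 j) (ω≡ρ+1 k) ωj<ωk))))

occ35142⇒pattern : ∀ {n} (σ : Permutation′ n) → Occ35142 (gOf σ) → ContainsPattern σ p35142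
occ35142⇒pattern {n} σ (occ35142 x₁ x₂ x₃ x₄ x₅ x₁<x₂ x₂<x₃ x₃<x₄ x₄<x₅ f₃<f₅ f₅<f₁ f₁<f₄ f₄<f₂) =
  contains-by-ranks σ p35142 ranks ranks-correct positions sorted
    (increasing₅ (toℕ ∘ positions) x₁<x₂ x₂<x₃ x₃<x₄ x₄<x₅) (increasing₅ sorted f₃<f₅ f₅<f₁ f₁<f₄ f₄<f₂)
    letter
  where
  g : Fin n → ℕ
  g = gOf σ
  positions : Fin 5 → Fin n
  positions = lookup (x₁ ∷ᵥ x₂ ∷ᵥ x₃ ∷ᵥ x₄ ∷ᵥ x₅ ∷ᵥ []ᵥ)
  sorted : Fin 5 → ℕ
  sorted = lookup (g x₃ ∷ᵥ g x₅ ∷ᵥ g x₁ ∷ᵥ g x₄ ∷ᵥ g x₂ ∷ᵥ []ᵥ)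
  ranks : Fin 5 → Fin 5
  ranks = lookup (suc (suc zero) ∷ᵥ suc (suc (suc (suc zero))) ∷ᵥ zero ∷ᵥ suc (suc (suc zero)) ∷ᵥ suc zero ∷ᵥ []ᵥ)
  ranks-correct : ∀ j → p35142 j ≡ suc (toℕ (ranks j))
  ranks-correct zero = refl
  ranks-correct (suc zero) = refl
  ranks-correct (suc (suc zero)) = refl
  ranks-correct (suc (suc (suc zero))) = refl
  ranks-correct (suc (suc (suc (suc zero)))) = refl
  letter : ∀ j → g (positions j) ≡ sorted (ranks j)
  letter zero = refl
  letter (suc zero) = refl
  letter (suc (suc zero)) = refl
  letter (suc (suc (suc zero))) = refl
  letter (suc (suc (suc (suc zero)))) = refl

occ42513⇒pattern : ∀ {n} (σ : Permutation′ n) → Occ42513 (gOf σ) → ContainsPattern σ p42513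
occ42513⇒pattern {n} σ (occ42513 y₁ y₂ y₃ y₄ y₅ y₁<y₂ y₂<y₃ y₃<y₄ y₄<y₅ f₄<f₂ f₂<f₅ f₅<f₁ f₁<f₃) =
  contains-by-ranks σ p42513 ranks ranks-correct positions sorted
    (increasing₅ (toℕ ∘ positions) y₁<y₂ y₂<y₃ y₃<y₄ y₄<y₅) (increasing₅ sorted f₄<f₂ f₂<f₅ f₅<f₁ f₁<f₃)
    letter
  where
  g : Fin n → ℕ
  g = gOf σ
  positions : Fin 5 → Fin n
  positions = lookup (y₁ ∷ᵥ y₂ ∷ᵥ y₃ ∷ᵥ y₄ ∷ᵥ y₅ ∷ᵥ []ᵥ)
  sorted : Fin 5 → ℕ
  sorted = lookup (g y₄ ∷ᵥ g y₂ ∷ᵥ g y₅ ∷ᵥ g y₁ ∷ᵥ g y₃ ∷ᵥ []ᵥ)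
  ranks : Fin 5 → Fin 5
  ranks = lookup (suc (suc (suc zero)) ∷ᵥ suc zero ∷ᵥ suc (suc (suc (suc zero))) ∷ᵥ zero ∷ᵥ suc (suc zero) ∷ᵥ []ᵥ)
  ranks-correct : ∀ j → p42513 j ≡ suc (toℕ (ranks j))
  ranks-correct zero = refl
  ranks-correct (suc zero) = refl
  ranks-correct (suc (suc zero)) = refl
  ranks-correct (suc (suc (suc zero))) = refl
  ranks-correct (suc (suc (suc (suc zero)))) = refl
  letter : ∀ j → g (positions j) ≡ sorted (ranks j)
  letter zero = refl
  letter (suc zero) = refl
  letter (suc (suc zero)) = refl
  letter (suc (suc (suc zero))) = refl
  letter (suc (suc (suc (suc zero)))) = refl

-- Γ(σ) is the reverse-complement of σ⁻¹ and Γ(σ)⁻¹ that of σ, so the exposed double descent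
-- witnessing that Γ(σ) is not double simsun is a sunken one of σ⁻¹ or of σ.
proposition4p1 : (n : ℕ) (σ : Permutation′ n) → DoubleSimsun σ → ¬ DoubleSimsun (Γ σ)
    → ContainsPattern (Γ σ) p42513 × ContainsPattern σ p35142
proposition4p1 n σ (σ-simsun , σ⁻¹-simsun) Γ-not-double =
  occ42513⇒pattern (Γ σ) (occ35142-rc (flip σ ⟨$⟩ʳ_) in-σ⁻¹) , occ35142⇒pattern σ in-σ
  where
  occurrences : Occ35142 (gOf σ) × Occ35142 (gOf (flip σ))
  occurrences with simsun-or-exposed (Γ σ) | simsun-or-exposed (flip (Γ σ))
  ... | inj₁ Γ-simsun | inj₁ Γ⁻¹-simsun = ⊥-elim (Γ-not-double (Γ-simsun , Γ⁻¹-simsun))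
  ... | inj₂ e | _ = occ35142-inverse (flip σ) occ , occ
    where
    occ : Occ35142 (gOf (flip σ))
    occ = sunken⇒35142 (flip σ) σ⁻¹-simsun σ-simsun (exposed-rc⇒sunken (flip σ ⟨$⟩ʳ_) e)
  ... | inj₁ _ | inj₂ e = occ , occ35142-inverse σ occ
    where
    occ : Occ35142 (gOf σ)
    occ = sunken⇒35142 σ σ-simsun σ⁻¹-simsun (exposed-rc⇒sunken (σ ⟨$⟩ʳ_) e)
  in-σ : Occ35142 (gOf σ)
  in-σ = proj₁ occurrences
  in-σ⁻¹ : Occ35142 (gOf (flip σ))
  in-σ⁻¹ = proj₂ occurrences
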